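{- Let $K$ be a field with a non-trivial valuation $v$, let $A(x)=\sum_{i=0}^n a_ix^i\in K[x]$ be a polynomial of degree $n$ with $a_0\neq 0$ and $n\cdot 1_K\neq 0$, and let $B(x)=\sum_{i=0}^n a_{n-i}x^i$. Then $$U(B(x))=L(A(x))\begin{pmatrix}0&1\\1&0\end{pmatrix}.$$ Furthermore, $L(A(x))$ is an Eisenstein–Dumas polynomial at $v$ if and only if $U(B(x))$ is an Eisenstein–Dumas polynomial at $v$.
   Context: $v:K\to\Gamma\cup\{\infty\}$ is a non-trivial Krull valuation with values in a linearly ordered abelian group $\Gamma$. Action of $GL(2,K)$ on polynomials of degree $n$: $P(x)\begin{pmatrix}a&b\\c&d\end{pmatrix}=(cx+d)^nP\big(\frac{ax+b}{cx+d}\big)$, the result regarded as a polynomial of formal degree $n$. For $P(x)=\sum_{i=0}^n p_ix^i$ of degree $n$: $U(P(x))=P(x)\begin{pmatrix}1&-\frac{p_{n-1}}{np_n}\\0&1\end{pmatrix}=P\big(x-\frac{p_{n-1}}{np_n}\big)$, and, if $p_0\ne0$, $L(P(x))=P(x)\begin{pmatrix}1&0\\-\frac{p_1}{np_0}&1\end{pmatrix}$. (Here $B$ has degree $n$ with leading coefficient $a_0$.) For a polynomial written $\sum_{i=0}^n b_ix^i$ with specified $n$, it is Eisenstein–Dumas at $v$ if (D0) $b_0b_n\neq0$; (D1) $v(b_0)-v(b_n)\notin k\Gamma$ for every integer $k>1$ dividing $n$; (D2) $nv(b_i)\ge (n-i)v(b_0)+iv(b_n)$ for $0\le i\le n$.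 -}

module Defs where

open import Level using (Level; _⊔_) renaming (suc to lsuc)
open import Algebra.Bundles using (CommutativeRing; AbelianGroup)
open import Relation.Binary.Core using (Rel)
open import Relation.Binary.Structures using (IsTotalOrder)
open import Relation.Binary.PropositionalEquality using (_≡_)
open import Relation.Nullary using (¬_)
open import Data.Nat as ℕ using (ℕ; zero; suc; _∸_)
open import Data.Nat.Divisibility using (_∣_)
open import Data.Fin using (Fin; toℕ; opposite)
open import Data.List using (List; []; _∷_)
open import Data.Product using (Σ; _×_; _,_)
open import Data.Sum using (_⊎_)
open import Data.Unit.Polymorphic using (⊤)
open import Data.Empty.Polymorphic using (⊥)

-- Fields (a commutative ring with 0 ≠ 1 in which every nonzero element
-- is invertible; the inverse is given as a total operation whose value
-- at 0 is irrelevant).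

record Field (c ℓ : Level) : Set (lsuc (c ⊔ ℓ)) where
  field
    commutativeRing : CommutativeRing c ℓ
  open CommutativeRing commutativeRing public
  field
    _⁻¹        : Carrier → Carrier
    ⁻¹-cong    : ∀ {x y} → x ≈ y → (x ⁻¹) ≈ (y ⁻¹)
    0≉1        : ¬ (0# ≈ 1#)
    ⁻¹-inverse : ∀ x → ¬ (x ≈ 0#) → (x * (x ⁻¹)) ≈ 1#

  _/_ : Carrier → Carrier → Carrier
  x / y = x * (y ⁻¹)

  fromℕ : ℕ → Carrier
  fromℕ zero    = 0#
  fromℕ (suc n) = 1# + fromℕ n

-- Linearly ordered abelian groups (written multiplicatively as in the
-- stdlib AbelianGroup bundle, but thought of additively).

record LinOrdAbGroup (c ℓ₁ ℓ₂ : Level) : Set (lsuc (c ⊔ ℓ₁ ⊔ ℓ₂)) where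
  field
    abelianGroup : AbelianGroup c ℓ₁
  open AbelianGroup abelianGroup public
  field
    _≤_          : Rel Carrier ℓ₂
    isTotalOrder : IsTotalOrder _≈_ _≤_
    ∙-monoˡ-≤    : ∀ {x y} z → x ≤ y → (x ∙ z) ≤ (y ∙ z)

  _-ᵍ_ : Carrier → Carrier → Carrier
  x -ᵍ y = x ∙ (y ⁻¹)

  _·ᵍ_ : ℕ → Carrier → Carrier
  zero  ·ᵍ x = ε
  suc k ·ᵍ x = x ∙ (k ·ᵍ x)

data WithInf {c} (A : Set c) : Set c where
  fin : A → WithInf A
  ∞   : WithInf A

module Inf {c ℓ₁ ℓ₂} (Γ : LinOrdAbGroup c ℓ₁ ℓ₂) where
  open LinOrdAbGroup Γ

  Γ∞ : Set c
  Γ∞ = WithInf Carrier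

  _≈∞_ : Γ∞ → Γ∞ → Set ℓ₁
  fin x ≈∞ fin y = x ≈ y
  fin x ≈∞ ∞     = ⊥
  ∞     ≈∞ fin y = ⊥
  ∞     ≈∞ ∞     = ⊤

  _≤∞_ : Γ∞ → Γ∞ → Set ℓ₂
  fin x ≤∞ fin y = x ≤ y
  fin x ≤∞ ∞     = ⊤
  ∞     ≤∞ fin y = ⊥
  ∞     ≤∞ ∞     = ⊤

  _+∞_ : Γ∞ → Γ∞ → Γ∞
  fin x +∞ fin y = fin (x ∙ y)
  fin x +∞ ∞     = ∞
  ∞     +∞ y     = ∞

  -- k · γ; the convention 0 · ∞ = 0 is never used in the statement
  -- (only values of nonzero elements are multiplied by 0).
  _·∞_ : ℕ → Γ∞ → Γ∞
  k     ·∞ fin x = fin (k ·ᵍ x)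
  zero  ·∞ ∞     = fin ε
  suc k ·∞ ∞     = ∞

record Valuation {c ℓ c' ℓ₁ ℓ₂} (K : Field c ℓ) (Γ : LinOrdAbGroup c' ℓ₁ ℓ₂)
       : Set (c ⊔ ℓ ⊔ c' ⊔ ℓ₁ ⊔ ℓ₂) where
  open Field K
  open Inf Γ
  private module G = LinOrdAbGroup Γ
  field
    v          : Carrier → Γ∞
    v-cong     : ∀ {x y} → x ≈ y → v x ≈∞ v y
    v-∞        : ∀ x → (v x ≈∞ ∞ → x ≈ 0#) × (x ≈ 0# → v x ≈∞ ∞)
    v-mul      : ∀ x y → v (x * y) ≈∞ (v x +∞ v y)
    v-add      : ∀ x y → (v x ≤∞ v (x + y)) ⊎ (v y ≤∞ v (x + y))
    nontrivial : Σ Carrier (λ x → ¬ (x ≈ 0#) × ¬ (v x ≈∞ fin G.ε))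

module Polys {c ℓ} (K : Field c ℓ) where
  open Field K

  -- Polynomials of formal degree n: coefficients p_0 … p_n.
  Poly : ℕ → Set c
  Poly n = Fin (suc n) → Carrier

  _≈ₚ_ : ∀ {n} → Poly n → Poly n → Set ℓ
  P ≈ₚ Q = ∀ i → P i ≈ Q i

  -- coefficient p_i as a function of i ∈ ℕ (0 for i > n)
  coef : ∀ {n} → Poly n → ℕ → Carrier
  coef {n} P i = go n P i
    where
    go : ∀ m → Poly m → ℕ → Carrier
    go m       P zero    = P Fin.zero
    go zero    P (suc i) = 0#
    go (suc m) P (suc i) = go m (λ j → P (Fin.suc j)) i

  sumFin : ∀ n → (Fin n → Carrier) → Carrier
  sumFin zero    f = 0#
  sumFin (suc n) f = f Fin.zero + sumFin n (λ i → f (Fin.suc i))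

  -- auxiliary dense list polynomials (coefficient lists, lowest first)
  LPoly : Set c
  LPoly = List Carrier

  _+L_ : LPoly → LPoly → LPoly
  []       +L q        = q
  (a ∷ p)  +L []       = a ∷ p
  (a ∷ p)  +L (b ∷ q)  = (a + b) ∷ (p +L q)

  _⋆L_ : Carrier → LPoly → LPoly
  a ⋆L []      = []
  a ⋆L (b ∷ p) = (a * b) ∷ (a ⋆L p)

  _*L_ : LPoly → LPoly → LPoly
  []      *L q = []
  (a ∷ p) *L q = (a ⋆L q) +L (0# ∷ (p *L q))

  _^L_ : LPoly → ℕ → LPoly
  p ^L zero  = 1# ∷ []
  p ^L suc k = p *L (p ^L k)

  coefL : LPoly → ℕ → Carrier
  coefL []      i       = 0#
  coefL (a ∷ p) zero    = a
  coefL (a ∷ p) (suc i) = coefL p i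

  linL : Carrier → Carrier → LPoly
  linL a b = b ∷ a ∷ []

  -- P(x)·(a b; c d) = (cx+d)^n P((ax+b)/(cx+d)) = Σ_i p_i (ax+b)^i (cx+d)^(n-i),
  -- regarded as a polynomial of formal degree n.
  act : ∀ {n} → Poly n → Carrier → Carrier → Carrier → Carrier → Poly n
  act {n} P a b c d j =
    sumFin (suc n) (λ i → P i * coefL ((linL a b ^L toℕ i) *L (linL c d ^L (n ∸ toℕ i))) (toℕ j))

  U : ∀ {n} → Poly n → Poly n
  U {n} P = act P 1# (- (coef P (n ∸ 1) / (fromℕ n * coef P n))) 0# 1#

  L : ∀ {n} → Poly n → Poly n
  L {n} P = act P 1# 0# (- (coef P 1 / (fromℕ n * coef P 0))) 1#

  swap : ∀ {n} → Poly n → Poly n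
  swap P = act P 0# 1# 1# 0#

  reverse : ∀ {n} → Poly n → Poly n
  reverse P i = P (opposite i)

module ED {c ℓ c' ℓ₁ ℓ₂} {K : Field c ℓ} {Γ : LinOrdAbGroup c' ℓ₁ ℓ₂}
          (val : Valuation K Γ) where
  open Field K
  open Inf Γ
  open Polys K
  open Valuation val
  private module G = LinOrdAbGroup Γ

  record IsEisensteinDumas {n : ℕ} (P : Poly n) : Set (ℓ ⊔ c' ⊔ ℓ₁ ⊔ ℓ₂) where
    field
      D0 : ¬ (coef P 0 ≈ 0#) × ¬ (coef P n ≈ 0#)
      D1 : ∀ k → 1 ℕ.< k → k ∣ n → ∀ g₀ gₙ → v (coef P 0) ≡ fin g₀ → v (coef P n) ≡ fin gₙ →
           ∀ γ → ¬ ((k G.·ᵍ γ) G.≈ (g₀ G.-ᵍ gₙ))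
      D2 : ∀ (i : Fin (suc n)) →
           (((n ∸ toℕ i) ·∞ v (coef P 0)) +∞ (toℕ i ·∞ v (coef P n))) ≤∞ (n ·∞ v (P i))

-- Reversal x ↦ xⁿ P(1/x) is the action of (0 1; 1 0), so conjugating the lower unitriangular
-- substitution of L by it yields an upper unitriangular one; the two shift constants agree
-- because the relevant coefficients of B are those of A read backwards.  This gives
-- U(B) = L(A)·(0 1; 1 0) = reverse (L(A)), and the Eisenstein–Dumas conditions are symmetric
-- under reversal: (D2) exchanges the roles of b₀ and bₙ, and (D1) only changes the sign of
-- v(b₀) − v(bₙ).
module Submission where

open import Defs
open import Level using (Level; _⊔_)
import Algebra.Properties.CommutativeMonoid.Sum as MonoidSum
import Algebra.Properties.AbelianGroup as AbelianGroupProperties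
import Algebra.Properties.Group as GroupProperties
open import Data.Nat as ℕ using (ℕ; zero; suc; _∸_; z≤n; s≤s)
open import Data.Nat.Divisibility using (_∣_)
import Data.Nat.Properties as ℕₚ
open import Data.Fin using (Fin; toℕ; opposite; fromℕ<; punchIn)
open import Data.Fin.Properties
  using (opposite-prop; opposite-involutive; toℕ-injective; toℕ-fromℕ<; toℕ≤pred[n]; punchInᵢ≢i)
import Data.Fin.Permutation as Perm
open import Data.List using ([]; _∷_)
open import Data.Product using (Σ-syntax; _×_; _,_; proj₁; proj₂)
open import Data.Sum using (inj₁; inj₂)
open import Data.Unit.Polymorphic using (tt)
open import Function.Base using (_∘_)
open import Function.Bundles using (_⇔_; mk⇔; module Equivalence)
open import Relation.Nullary using (¬_; yes; no)
open import Relation.Nullary.Negation using (contradiction)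
open import Relation.Binary.PropositionalEquality as ≡ using (_≡_; _≢_)
open import Relation.Binary.Structures using (IsTotalOrder)

module CoefficientIndices {c ℓ} (K : Field c ℓ) where
  open Polys K
  open ≡.≡-Reasoning

  coef-toℕ : ∀ {n} (P : Poly n) i → coef P (toℕ i) ≡ P i
  coef-toℕ {n}     P Fin.zero    = ≡.refl
  coef-toℕ {suc n} P (Fin.suc i) = coef-toℕ {n} (P ∘ Fin.suc) i

  coef-reverse : ∀ {n} (P : Poly n) i → i ℕ.≤ n → coef (reverse P) i ≡ coef P (n ∸ i)
  coef-reverse {n} P i i≤n = begin
    coef (reverse P) i             ≡⟨ ≡.cong (coef (reverse P)) (toℕ-fromℕ< (s≤s i≤n)) ⟨
    coef (reverse P) (toℕ k)       ≡⟨ coef-toℕ (reverse P) k ⟩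
    P (opposite k)                 ≡⟨ coef-toℕ P (opposite k) ⟨
    coef P (toℕ (opposite k))      ≡⟨ ≡.cong (coef P) (opposite-prop k) ⟩
    coef P (n ∸ toℕ k)             ≡⟨ ≡.cong (λ l → coef P (n ∸ l)) (toℕ-fromℕ< (s≤s i≤n)) ⟩
    coef P (n ∸ i)                 ∎
    where
    k : Fin (suc n)
    k = fromℕ< (s≤s i≤n)

module ListCoefficients {c ℓ} (K : Field c ℓ) where
  open Field K hiding (zero; fromℕ)
  open Polys K
  open import Relation.Binary.Reasoning.Setoid setoid

  infix 4 _≈L_
  _≈L_ : LPoly → LPoly → Set ℓ
  p ≈L q = ∀ k → coefL p k ≈ coefL q k

  1L : LPoly
  1L = 1# ∷ []

  X : LPoly
  X = linL 1# 0#

  0∷[]≈L[] : 0# ∷ [] ≈L []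
  0∷[]≈L[] zero    = refl
  0∷[]≈L[] (suc k) = refl

  ∷-congˡ : ∀ a {p q} → p ≈L q → a ∷ p ≈L a ∷ q
  ∷-congˡ a p≈q zero    = refl
  ∷-congˡ a p≈q (suc k) = p≈q k

  coefL-+L : ∀ p q k → coefL (p +L q) k ≈ coefL p k + coefL q k
  coefL-+L []      q       k       = sym (+-identityˡ _)
  coefL-+L (a ∷ p) []      k       = sym (+-identityʳ _)
  coefL-+L (a ∷ p) (b ∷ q) zero    = refl
  coefL-+L (a ∷ p) (b ∷ q) (suc k) = coefL-+L p q k

  coefL-⋆L : ∀ a p k → coefL (a ⋆L p) k ≈ a * coefL p k
  coefL-⋆L a []      k       = sym (zeroʳ a)
  coefL-⋆L a (b ∷ p) zero    = refl
  coefL-⋆L a (b ∷ p) (suc k) = coefL-⋆L a p k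

  coefL-∷*L : ∀ a p q k → coefL ((a ∷ p) *L q) k ≈ a * coefL q k + coefL (0# ∷ (p *L q)) k
  coefL-∷*L a p q k = trans (coefL-+L (a ⋆L q) _ k) (+-congʳ (coefL-⋆L a q k))

  coefL-linL*L-zero : ∀ a b p → coefL (linL a b *L p) 0 ≈ b * coefL p 0
  coefL-linL*L-zero a b p = trans (coefL-∷*L b (a ∷ []) p 0) (+-identityʳ _)

  coefL-linL*L-suc : ∀ a b p k → coefL (linL a b *L p) (suc k) ≈ b * coefL p (suc k) + a * coefL p k
  coefL-linL*L-suc a b p k = begin
    coefL (linL a b *L p) (suc k)                          ≈⟨ coefL-∷*L b (a ∷ []) p (suc k) ⟩
    b * coefL p (suc k) + coefL ((a ⋆L p) +L (0# ∷ [])) k  ≈⟨ +-congˡ (coefL-+L (a ⋆L p) _ k) ⟩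
    b * coefL p (suc k) + (coefL (a ⋆L p) k + coefL (0# ∷ []) k)
      ≈⟨ +-congˡ (+-cong (coefL-⋆L a p k) (0∷[]≈L[] k)) ⟩
    b * coefL p (suc k) + (a * coefL p k + 0#)             ≈⟨ +-congˡ (+-identityʳ _) ⟩
    b * coefL p (suc k) + a * coefL p k                    ∎

  0∷-*L : ∀ p q → (0# ∷ p) *L q ≈L 0# ∷ (p *L q)
  0∷-*L p q k = trans (coefL-∷*L 0# p q k) (trans (+-congʳ (zeroˡ _)) (+-identityˡ _))

  *L-zeroˡ : ∀ p q → p ≈L [] → p *L q ≈L []
  *L-zeroˡ []      q p≈0 k = refl
  *L-zeroˡ (a ∷ p) q p≈0 k = begin
    coefL ((a ∷ p) *L q) k                ≈⟨ coefL-∷*L a p q k ⟩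
    a * coefL q k + coefL (0# ∷ (p *L q)) k ≈⟨ +-cong (*-congʳ (p≈0 0)) (tail≈0 k) ⟩
    0# * coefL q k + 0#                   ≈⟨ +-identityʳ _ ⟩
    0# * coefL q k                        ≈⟨ zeroˡ _ ⟩
    0#                                    ∎
    where
    tail≈0 : 0# ∷ (p *L q) ≈L []
    tail≈0 zero    = refl
    tail≈0 (suc k) = *L-zeroˡ p q (p≈0 ∘ suc) k

  *L-congʳ : ∀ p p' q → p ≈L p' → p *L q ≈L p' *L q
  *L-congʳ []      []       q p≈p' k = refl
  *L-congʳ []      (b ∷ p') q p≈p' k = sym (*L-zeroˡ (b ∷ p') q (sym ∘ p≈p') k)
  *L-congʳ (a ∷ p) []       q p≈p' k = *L-zeroˡ (a ∷ p) q p≈p' k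
  *L-congʳ (a ∷ p) (b ∷ p') q p≈p' k = begin
    coefL ((a ∷ p) *L q) k                    ≈⟨ coefL-∷*L a p q k ⟩
    a * coefL q k + coefL (0# ∷ (p *L q)) k
      ≈⟨ +-cong (*-congʳ (p≈p' 0)) (∷-congˡ 0# (*L-congʳ p p' q (p≈p' ∘ suc)) k) ⟩
    b * coefL q k + coefL (0# ∷ (p' *L q)) k  ≈⟨ coefL-∷*L b p' q k ⟨
    coefL ((b ∷ p') *L q) k                   ∎

  *L-identityʳ : ∀ p q → q ≈L 1L → p *L q ≈L p
  *L-identityʳ []      q q≈1 k       = refl
  *L-identityʳ (a ∷ p) q q≈1 zero    = begin
    coefL ((a ∷ p) *L q) 0  ≈⟨ coefL-∷*L a p q 0 ⟩
    a * coefL q 0 + 0#      ≈⟨ +-identityʳ _ ⟩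
    a * coefL q 0           ≈⟨ *-congˡ (q≈1 0) ⟩
    a * 1#                  ≈⟨ *-identityʳ a ⟩
    a                       ∎
  *L-identityʳ (a ∷ p) q q≈1 (suc k) = begin
    coefL ((a ∷ p) *L q) (suc k)              ≈⟨ coefL-∷*L a p q (suc k) ⟩
    a * coefL q (suc k) + coefL (p *L q) k    ≈⟨ +-cong (*-congˡ (q≈1 (suc k))) (*L-identityʳ p q q≈1 k) ⟩
    a * 0# + coefL p k                        ≈⟨ +-congʳ (zeroʳ a) ⟩
    0# + coefL p k                            ≈⟨ +-identityˡ _ ⟩
    coefL p k                                 ∎

  *L-identityˡ : ∀ p q → p ≈L 1L → p *L q ≈L q
  *L-identityˡ p q p≈1 k = begin
    coefL (p *L q) k                  ≈⟨ *L-congʳ p 1L q p≈1 k ⟩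
    coefL (1L *L q) k                 ≈⟨ coefL-∷*L 1# [] q k ⟩
    1# * coefL q k + coefL (0# ∷ []) k ≈⟨ +-cong (*-identityˡ _) (0∷[]≈L[] k) ⟩
    coefL q k + 0#                    ≈⟨ +-identityʳ _ ⟩
    coefL q k                         ∎

  linL01^L≈1L : ∀ m → linL 0# 1# ^L m ≈L 1L
  linL01^L≈1L zero    k = refl
  linL01^L≈1L (suc m) k = trans (*L-identityˡ (linL 0# 1#) (linL 0# 1# ^L m) linL01≈1L k) (linL01^L≈1L m k)
    where
    linL01≈1L : linL 0# 1# ≈L 1L
    linL01≈1L zero          = refl
    linL01≈1L (suc zero)    = refl
    linL01≈1L (suc (suc k)) = refl

  X^L-suc : ∀ i → X ^L suc i ≈L 0# ∷ (X ^L i)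
  X^L-suc i k = trans (0∷-*L 1L (X ^L i) k) (∷-congˡ 0# (*L-identityˡ 1L (X ^L i) (λ _ → refl)) k)

  coefL-X^L-diag : ∀ m → coefL (X ^L m) m ≈ 1#
  coefL-X^L-diag zero    = refl
  coefL-X^L-diag (suc m) = trans (X^L-suc m (suc m)) (coefL-X^L-diag m)

  coefL-X^L-off : ∀ m k → m ≢ k → coefL (X ^L m) k ≈ 0#
  coefL-X^L-off zero    zero    m≢k = contradiction ≡.refl m≢k
  coefL-X^L-off zero    (suc k) m≢k = refl
  coefL-X^L-off (suc m) zero    m≢k = X^L-suc m 0
  coefL-X^L-off (suc m) (suc k) m≢k =
    trans (X^L-suc m (suc k)) (coefL-X^L-off m k (m≢k ∘ ≡.cong suc))

  coefL-X^L*L-+ : ∀ i q k → coefL ((X ^L i) *L q) (i ℕ.+ k) ≈ coefL q k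
  coefL-X^L*L-+ zero    q k = *L-identityˡ 1L q (λ _ → refl) k
  coefL-X^L*L-+ (suc i) q k = begin
    coefL ((X ^L suc i) *L q) (suc (i ℕ.+ k))    ≈⟨ *L-congʳ (X ^L suc i) (0# ∷ (X ^L i)) q (X^L-suc i) (suc (i ℕ.+ k)) ⟩
    coefL ((0# ∷ (X ^L i)) *L q) (suc (i ℕ.+ k)) ≈⟨ 0∷-*L (X ^L i) q _ ⟩
    coefL ((X ^L i) *L q) (i ℕ.+ k)              ≈⟨ coefL-X^L*L-+ i q k ⟩
    coefL q k                                    ∎

  coefL-X^L*L-< : ∀ i q k → k ℕ.< i → coefL ((X ^L i) *L q) k ≈ 0#
  coefL-X^L*L-< (suc i) q k k<1+i = begin
    coefL ((X ^L suc i) *L q) k    ≈⟨ *L-congʳ (X ^L suc i) (0# ∷ (X ^L i)) q (X^L-suc i) k ⟩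
    coefL ((0# ∷ (X ^L i)) *L q) k ≈⟨ 0∷-*L (X ^L i) q k ⟩
    coefL (0# ∷ ((X ^L i) *L q)) k ≈⟨ lower k k<1+i ⟩
    0#                             ∎
    where
    lower : ∀ k → k ℕ.< suc i → coefL (0# ∷ ((X ^L i) *L q)) k ≈ 0#
    lower zero    _             = refl
    lower (suc k) (s≤s k<i)     = coefL-X^L*L-< i q k k<i

  coefL-linL^L-> : ∀ a b m j → m ℕ.< j → coefL (linL a b ^L m) j ≈ 0#
  coefL-linL^L-> a b zero    (suc j) _             = refl
  coefL-linL^L-> a b (suc m) (suc j) (s≤s m<j) = begin
    coefL (linL a b *L (linL a b ^L m)) (suc j)                         ≈⟨ coefL-linL*L-suc a b (linL a b ^L m) j ⟩
    b * coefL (linL a b ^L m) (suc j) + a * coefL (linL a b ^L m) j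
      ≈⟨ +-cong (*-congˡ (coefL-linL^L-> a b m (suc j) (ℕₚ.m<n⇒m<1+n m<j)))
                (*-congˡ (coefL-linL^L-> a b m j m<j)) ⟩
    b * 0# + a * 0#                                                      ≈⟨ +-cong (zeroʳ b) (zeroʳ a) ⟩
    0# + 0#                                                              ≈⟨ +-identityˡ 0# ⟩
    0#                                                                   ∎

  coefL-linL^L-reflect : ∀ a b m j → j ℕ.≤ m → coefL (linL a b ^L m) j ≈ coefL (linL b a ^L m) (m ∸ j)
  coefL-linL^L-reflect a b zero    zero    z≤n = refl
  coefL-linL^L-reflect a b (suc m) zero    z≤n = begin
    coefL (linL a b *L p) 0                  ≈⟨ coefL-linL*L-zero a b p ⟩
    b * coefL p 0                            ≈⟨ *-congˡ (coefL-linL^L-reflect a b m 0 z≤n) ⟩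
    b * coefL q m                            ≈⟨ +-identityˡ _ ⟨
    0# + b * coefL q m                       ≈⟨ +-congʳ (zeroʳ a) ⟨
    a * 0# + b * coefL q m                   ≈⟨ +-congʳ (*-congˡ (coefL-linL^L-> b a m (suc m) (ℕₚ.n<1+n m))) ⟨
    a * coefL q (suc m) + b * coefL q m      ≈⟨ coefL-linL*L-suc b a q m ⟨
    coefL (linL b a *L q) (suc m)            ∎
    where
    p q : LPoly
    p = linL a b ^L m
    q = linL b a ^L m
  coefL-linL^L-reflect a b (suc m) (suc j) (s≤s j≤m) with ℕₚ.m≤n⇒m<n∨m≡n j≤m
  ... | inj₂ ≡.refl = begin
    coefL (linL a b *L p) (suc j)            ≈⟨ coefL-linL*L-suc a b p j ⟩
    b * coefL p (suc j) + a * coefL p j      ≈⟨ +-congʳ (*-congˡ (coefL-linL^L-> a b j (suc j) (ℕₚ.n<1+n j))) ⟩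
    b * 0# + a * coefL p j                   ≈⟨ +-congʳ (zeroʳ b) ⟩
    0# + a * coefL p j                       ≈⟨ +-identityˡ _ ⟩
    a * coefL p j                            ≈⟨ *-congˡ (coefL-linL^L-reflect a b j j ℕₚ.≤-refl) ⟩
    a * coefL q (j ∸ j)                      ≡⟨ ≡.cong (λ k → a * coefL q k) (ℕₚ.n∸n≡0 j) ⟩
    a * coefL q 0                            ≈⟨ coefL-linL*L-zero b a q ⟨
    coefL (linL b a *L q) 0                  ≡⟨ ≡.cong (coefL (linL b a *L q)) (ℕₚ.n∸n≡0 j) ⟨
    coefL (linL b a *L q) (j ∸ j)            ∎
    where
    p q : LPoly
    p = linL a b ^L j
    q = linL b a ^L j
  ... | inj₁ j<m = begin
    coefL (linL a b *L p) (suc j)                        ≈⟨ coefL-linL*L-suc a b p j ⟩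
    b * coefL p (suc j) + a * coefL p j                  ≈⟨ +-comm _ _ ⟩
    a * coefL p j + b * coefL p (suc j)
      ≈⟨ +-cong (*-congˡ (coefL-linL^L-reflect a b m j j≤m)) (*-congˡ (coefL-linL^L-reflect a b m (suc j) j<m)) ⟩
    a * coefL q (m ∸ j) + b * coefL q (m ∸ suc j)
      ≡⟨ ≡.cong (λ k → a * coefL q k + b * coefL q (m ∸ suc j)) m∸j≡1+m∸1+j ⟩
    a * coefL q (suc (m ∸ suc j)) + b * coefL q (m ∸ suc j) ≈⟨ coefL-linL*L-suc b a q (m ∸ suc j) ⟨
    coefL (linL b a *L q) (suc (m ∸ suc j))              ≡⟨ ≡.cong (coefL (linL b a *L q)) m∸j≡1+m∸1+j ⟨
    coefL (linL b a *L q) (m ∸ j)                        ∎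
    where
    p q : LPoly
    p = linL a b ^L m
    q = linL b a ^L m
    m∸j≡1+m∸1+j : m ∸ j ≡ suc (m ∸ suc j)
    m∸j≡1+m∸1+j = ℕₚ.+-∸-assoc 1 j<m

  -- Substituting x ↦ 1/x in (x + t)ᵐ and clearing denominators by x^(i+m) gives xⁱ (tx + 1)ᵐ.
  coefL-translate-reflect : ∀ t i m j → j ℕ.≤ i ℕ.+ m →
    coefL (linL 1# t ^L m) j ≈ coefL ((X ^L i) *L (linL t 1# ^L m)) (i ℕ.+ m ∸ j)
  coefL-translate-reflect t i m j j≤i+m with j ℕ.≤? m
  ... | yes j≤m = begin
    coefL (linL 1# t ^L m) j                             ≈⟨ coefL-linL^L-reflect 1# t m j j≤m ⟩
    coefL (linL t 1# ^L m) (m ∸ j)                       ≈⟨ coefL-X^L*L-+ i _ (m ∸ j) ⟨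
    coefL ((X ^L i) *L (linL t 1# ^L m)) (i ℕ.+ (m ∸ j)) ≡⟨ ≡.cong (coefL ((X ^L i) *L _)) (ℕₚ.+-∸-assoc i j≤m) ⟨
    coefL ((X ^L i) *L (linL t 1# ^L m)) (i ℕ.+ m ∸ j)   ∎
  ... | no j≰m = trans (coefL-linL^L-> 1# t m j m<j) (sym (coefL-X^L*L-< i _ _ i+m∸j<i))
    where
    m<j : m ℕ.< j
    m<j = ℕₚ.≰⇒> j≰m
    i+m∸j<i : i ℕ.+ m ∸ j ℕ.< i
    i+m∸j<i = ℕₚ.≤-trans (ℕₚ.∸-monoʳ-< m<j j≤i+m) (ℕₚ.≤-reflexive (ℕₚ.m+n∸n≡m i m))

module FiniteSums {c ℓ} (K : Field c ℓ) where
  open Field K hiding (zero; fromℕ)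
  open Polys K
  open import Relation.Binary.Reasoning.Setoid setoid
  open MonoidSum +-commutativeMonoid using (sum; sum-permute; sum-remove; sum-cong-≋; sum-replicate-zero)

  sumFin≡sum : ∀ n (f : Fin n → Carrier) → sumFin n f ≡ sum f
  sumFin≡sum zero    f = ≡.refl
  sumFin≡sum (suc n) f = ≡.cong (f Fin.zero +_) (sumFin≡sum n (f ∘ Fin.suc))

  sumFin-cong : ∀ n {f g : Fin n → Carrier} → (∀ i → f i ≈ g i) → sumFin n f ≈ sumFin n g
  sumFin-cong n {f} {g} f≈g = begin
    sumFin n f ≡⟨ sumFin≡sum n f ⟩
    sum f      ≈⟨ sum-cong-≋ f≈g ⟩
    sum g      ≡⟨ sumFin≡sum n g ⟨
    sumFin n g ∎

  sumFin-reverse : ∀ n (f : Fin n → Carrier) → sumFin n f ≈ sumFin n (f ∘ opposite)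
  sumFin-reverse n f = begin
    sumFin n f              ≡⟨ sumFin≡sum n f ⟩
    sum f                   ≈⟨ sum-permute f Perm.reverse ⟩
    sum (f ∘ opposite)      ≡⟨ sumFin≡sum n (f ∘ opposite) ⟨
    sumFin n (f ∘ opposite) ∎

  sumFin-δ : ∀ n (f : Fin (suc n) → Carrier) i → (∀ j → j ≢ i → f j ≈ 0#) → sumFin (suc n) f ≈ f i
  sumFin-δ n f i f≈0 = begin
    sumFin (suc n) f                   ≡⟨ sumFin≡sum (suc n) f ⟩
    sum f                              ≈⟨ sum-remove f ⟩
    f i + sum (f ∘ punchIn i)          ≈⟨ +-congˡ (sum-cong-≋ (λ j → f≈0 (punchIn i j) (punchInᵢ≢i i j))) ⟩
    f i + sum {n} (λ _ → 0#)           ≈⟨ +-congˡ (sum-replicate-zero n) ⟩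
    f i + 0#                           ≈⟨ +-identityʳ _ ⟩
    f i                                ∎

module Substitutions {c ℓ} (K : Field c ℓ) where
  open Field K hiding (zero; fromℕ)
  open Polys K
  open import Relation.Binary.Reasoning.Setoid setoid
  open ListCoefficients K
  open FiniteSums K
  open CoefficientIndices K using (coef-reverse)

  coef-cong : ∀ {n} {P Q : Poly n} → P ≈ₚ Q → ∀ i → coef P i ≈ coef Q i
  coef-cong {n}     P≈Q zero    = P≈Q Fin.zero
  coef-cong {zero}  P≈Q (suc i) = refl
  coef-cong {suc n} P≈Q (suc i) = coef-cong {n} (P≈Q ∘ Fin.suc) i

  swap≈ₚreverse : ∀ {n} (P : Poly n) → swap P ≈ₚ reverse P
  swap≈ₚreverse {n} P j = begin
    sumFin (suc n) (λ i → P i * coefL ((linL 0# 1# ^L toℕ i) *L (X ^L (n ∸ toℕ i))) (toℕ j))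
      ≈⟨ sumFin-cong (suc n) (λ i → *-congˡ {P i}
           (*L-identityˡ (linL 0# 1# ^L toℕ i) (X ^L (n ∸ toℕ i)) (linL01^L≈1L (toℕ i)) (toℕ j))) ⟩
    sumFin (suc n) (λ i → P i * coefL (X ^L (n ∸ toℕ i)) (toℕ j))
      ≈⟨ sumFin-δ n _ (opposite j) off-diagonal ⟩
    P (opposite j) * coefL (X ^L (n ∸ toℕ (opposite j))) (toℕ j)
      ≡⟨ ≡.cong (λ m → P (opposite j) * coefL (X ^L m) (toℕ j)) n∸opposite ⟩
    P (opposite j) * coefL (X ^L toℕ j) (toℕ j)       ≈⟨ *-congˡ (coefL-X^L-diag (toℕ j)) ⟩
    P (opposite j) * 1#                               ≈⟨ *-identityʳ _ ⟩
    P (opposite j)                                    ∎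
    where
    n∸opposite : n ∸ toℕ (opposite j) ≡ toℕ j
    n∸opposite = ≡.trans (≡.cong (n ∸_) (opposite-prop j)) (ℕₚ.m∸[m∸n]≡n (toℕ≤pred[n] j))
    off-diagonal : ∀ i → i ≢ opposite j → P i * coefL (X ^L (n ∸ toℕ i)) (toℕ j) ≈ 0#
    off-diagonal i i≢ = trans (*-congˡ (coefL-X^L-off _ _ (i≢ ∘ index))) (zeroʳ _)
      where
      index : n ∸ toℕ i ≡ toℕ j → i ≡ opposite j
      index eq = ≡.trans (≡.sym (opposite-involutive i))
                         (≡.cong opposite (toℕ-injective (≡.trans (opposite-prop i) eq)))

  act-reverse-upper : ∀ {n} (A : Poly n) t → act (reverse A) 1# t 0# 1# ≈ₚ reverse (act A 1# 0# t 1#)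
  act-reverse-upper {n} A t j = begin
    sumFin (suc n) (λ i → A (opposite i) * coefL ((linL 1# t ^L toℕ i) *L (linL 0# 1# ^L (n ∸ toℕ i))) (toℕ j))
      ≈⟨ sumFin-cong (suc n) (λ i → *-congˡ {A (opposite i)}
           (*L-identityʳ (linL 1# t ^L toℕ i) (linL 0# 1# ^L (n ∸ toℕ i)) (linL01^L≈1L (n ∸ toℕ i)) (toℕ j))) ⟩
    sumFin (suc n) (λ i → A (opposite i) * coefL (linL 1# t ^L toℕ i) (toℕ j))
      ≈⟨ sumFin-reverse (suc n) (λ i → A (opposite i) * coefL (linL 1# t ^L toℕ i) (toℕ j)) ⟩
    sumFin (suc n) (λ i → A (opposite (opposite i)) * coefL (linL 1# t ^L toℕ (opposite i)) (toℕ j))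
      ≈⟨ sumFin-cong (suc n) (λ i → reflexive (≡.cong₂ (λ k l → A k * coefL (linL 1# t ^L l) (toℕ j))
                                                        (opposite-involutive i) (opposite-prop i))) ⟩
    sumFin (suc n) (λ i → A i * coefL (linL 1# t ^L (n ∸ toℕ i)) (toℕ j))
      ≈⟨ sumFin-cong (suc n) (λ i → *-congˡ {A i} (term i)) ⟩
    sumFin (suc n) (λ i → A i * coefL ((X ^L toℕ i) *L (linL t 1# ^L (n ∸ toℕ i))) (toℕ (opposite j))) ∎
    where
    term : ∀ i → coefL (linL 1# t ^L (n ∸ toℕ i)) (toℕ j)
               ≈ coefL ((X ^L toℕ i) *L (linL t 1# ^L (n ∸ toℕ i))) (toℕ (opposite j))
    term i = begin
      coefL (linL 1# t ^L m) (toℕ j)                                  ≈⟨ coefL-translate-reflect t (toℕ i) m (toℕ j) j≤i+m ⟩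
      coefL ((X ^L toℕ i) *L (linL t 1# ^L m)) (toℕ i ℕ.+ m ∸ toℕ j) ≡⟨ ≡.cong (coefL ((X ^L toℕ i) *L _)) index ⟩
      coefL ((X ^L toℕ i) *L (linL t 1# ^L m)) (toℕ (opposite j))    ∎
      where
      m : ℕ
      m = n ∸ toℕ i
      i+m≡n : toℕ i ℕ.+ m ≡ n
      i+m≡n = ℕₚ.m+[n∸m]≡n (toℕ≤pred[n] i)
      j≤i+m : toℕ j ℕ.≤ toℕ i ℕ.+ m
      j≤i+m = ≡.subst (toℕ j ℕ.≤_) (≡.sym i+m≡n) (toℕ≤pred[n] j)
      index : toℕ i ℕ.+ m ∸ toℕ j ≡ toℕ (opposite j)
      index = ≡.trans (≡.cong (_∸ toℕ j) i+m≡n) (≡.sym (opposite-prop j))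

  U-reverse≈ₚreverse-L : ∀ m (A : Poly (suc m)) → U (reverse A) ≈ₚ reverse (L A)
  U-reverse≈ₚreverse-L m A =
    ≡.subst (λ s → act (reverse A) 1# s 0# 1# ≈ₚ reverse (L A)) (≡.sym same-shift) (act-reverse-upper A shiftL)
    where
    shiftL : Carrier
    shiftL = - (coef A 1 / (Field.fromℕ K (suc m) * coef A 0))
    same-shift : - (coef (reverse A) m / (Field.fromℕ K (suc m) * coef (reverse A) (suc m))) ≡ shiftL
    same-shift = ≡.cong₂ (λ a₁ a₀ → - (a₁ / (Field.fromℕ K (suc m) * a₀)))
      (≡.trans (coef-reverse A m (ℕₚ.n≤1+n m)) (≡.cong (coef A) (ℕₚ.m+n∸n≡m 1 m)))
      (≡.trans (coef-reverse A (suc m) ℕₚ.≤-refl) (≡.cong (coef A) (ℕₚ.n∸n≡0 (suc m))))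

module ValueArithmetic {c ℓ₁ ℓ₂} (Γ : LinOrdAbGroup c ℓ₁ ℓ₂) where
  open LinOrdAbGroup Γ
  open Inf Γ
  open GroupProperties group using (ε⁻¹≈ε)
  open AbelianGroupProperties abelianGroup using (⁻¹-∙-comm)

  ·ᵍ-cong : ∀ k {x y} → x ≈ y → (k ·ᵍ x) ≈ (k ·ᵍ y)
  ·ᵍ-cong zero    x≈y = refl
  ·ᵍ-cong (suc k) x≈y = ∙-cong x≈y (·ᵍ-cong k x≈y)

  ·ᵍ-⁻¹ : ∀ k x → (k ·ᵍ (x ⁻¹)) ≈ ((k ·ᵍ x) ⁻¹)
  ·ᵍ-⁻¹ zero    x = sym ε⁻¹≈ε
  ·ᵍ-⁻¹ (suc k) x = trans (∙-congˡ (·ᵍ-⁻¹ k x)) (⁻¹-∙-comm x (k ·ᵍ x))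

  -- An inductive copy of _≈∞_, so that its arguments can be inferred by unification.
  infix 4 _≃∞_
  data _≃∞_ : Γ∞ → Γ∞ → Set (c ⊔ ℓ₁) where
    fin≃ : ∀ {x y} → x ≈ y → fin x ≃∞ fin y
    ∞≃   : ∞ ≃∞ ∞

  ≈∞⇒≃∞ : ∀ x y → x ≈∞ y → x ≃∞ y
  ≈∞⇒≃∞ (fin x) (fin y) x≈y = fin≃ x≈y
  ≈∞⇒≃∞ ∞       ∞       _   = ∞≃

  ≃∞-refl : ∀ x → x ≃∞ x
  ≃∞-refl (fin x) = fin≃ refl
  ≃∞-refl ∞       = ∞≃

  ≃∞-fin : ∀ {x g} → x ≃∞ fin g → Σ[ h ∈ Carrier ] (x ≡ fin h) × (h ≈ g)
  ≃∞-fin (fin≃ {h} h≈g) = h , ≡.refl , h≈g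

  ·∞-cong : ∀ k {x y} → x ≃∞ y → (k ·∞ x) ≃∞ (k ·∞ y)
  ·∞-cong k       (fin≃ x≈y) = fin≃ (·ᵍ-cong k x≈y)
  ·∞-cong zero    ∞≃         = fin≃ refl
  ·∞-cong (suc k) ∞≃         = ∞≃

  +∞-cong : ∀ {x x' y y'} → x ≃∞ x' → y ≃∞ y' → (x +∞ y) ≃∞ (x' +∞ y')
  +∞-cong (fin≃ x≈x') (fin≃ y≈y') = fin≃ (∙-cong x≈x' y≈y')
  +∞-cong (fin≃ x≈x') ∞≃          = ∞≃
  +∞-cong ∞≃          _           = ∞≃

  +∞-comm : ∀ x y → (x +∞ y) ≃∞ (y +∞ x)
  +∞-comm (fin x) (fin y) = fin≃ (comm x y)
  +∞-comm (fin x) ∞       = ∞≃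
  +∞-comm ∞       (fin y) = ∞≃
  +∞-comm ∞       ∞       = ∞≃

  ≤∞-resp : ∀ {x x' y y'} → x ≃∞ x' → y ≃∞ y' → x ≤∞ y → x' ≤∞ y'
  ≤∞-resp (fin≃ x≈x') (fin≃ y≈y') x≤y =
    IsTotalOrder.≲-respʳ-≈ isTotalOrder y≈y' (IsTotalOrder.≲-respˡ-≈ isTotalOrder x≈x' x≤y)
  ≤∞-resp (fin≃ _)    ∞≃          _   = tt
  ≤∞-resp ∞≃          ∞≃          _   = tt

module EisensteinDumasSymmetry {c ℓ c' ℓ₁ ℓ₂} {K : Field c ℓ} {Γ : LinOrdAbGroup c' ℓ₁ ℓ₂}
                               (val : Valuation K Γ) where
  private
    module F = Field K
    module G = LinOrdAbGroup Γ
  open Inf Γ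
  open Polys K
  open Valuation val
  open ED val
  open ValueArithmetic Γ
  open Substitutions K using (coef-cong)
  open CoefficientIndices K using (coef-reverse)
  open GroupProperties G.group using (⁻¹-anti-homo-//)

  v-cong≃ : ∀ {a b} → a F.≈ b → v a ≃∞ v b
  v-cong≃ {a} {b} a≈b = ≈∞⇒≃∞ (v a) (v b) (v-cong a≈b)

  isEisensteinDumas-resp : ∀ {n} {P Q : Poly n} → P ≈ₚ Q → IsEisensteinDumas P → IsEisensteinDumas Q
  isEisensteinDumas-resp {n} {P} {Q} P≈Q isED = record { D0 = d0 ; D1 = d1 ; D2 = d2 }
    where
    open IsEisensteinDumas isED
    d0 : ¬ (coef Q 0 F.≈ F.0#) × ¬ (coef Q n F.≈ F.0#)
    d0 = (proj₁ D0 ∘ F.trans (coef-cong P≈Q 0)) , (proj₂ D0 ∘ F.trans (coef-cong P≈Q n))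
    d1 : ∀ k → 1 ℕ.< k → k ∣ n → ∀ g₀ gₙ → v (coef Q 0) ≡ fin g₀ → v (coef Q n) ≡ fin gₙ →
         ∀ γ → ¬ ((k G.·ᵍ γ) G.≈ (g₀ G.-ᵍ gₙ))
    d1 k 1<k k∣n g₀ gₙ vQ₀ vQₙ γ kγ≈
      with ≃∞-fin (≡.subst (v (coef P 0) ≃∞_) vQ₀ (v-cong≃ (coef-cong P≈Q 0)))
         | ≃∞-fin (≡.subst (v (coef P n) ≃∞_) vQₙ (v-cong≃ (coef-cong P≈Q n)))
    ... | h₀ , vP₀ , h₀≈g₀ | hₙ , vPₙ , hₙ≈gₙ =
      D1 k 1<k k∣n h₀ hₙ vP₀ vPₙ γ (G.trans kγ≈ (G.∙-cong (G.sym h₀≈g₀) (G.⁻¹-cong (G.sym hₙ≈gₙ))))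
    d2 : ∀ i → (((n ∸ toℕ i) ·∞ v (coef Q 0)) +∞ (toℕ i ·∞ v (coef Q n))) ≤∞ (n ·∞ v (Q i))
    d2 i = ≤∞-resp (+∞-cong (·∞-cong (n ∸ toℕ i) (v-cong≃ (coef-cong P≈Q 0)))
                            (·∞-cong (toℕ i) (v-cong≃ (coef-cong P≈Q n))))
                   (·∞-cong n (v-cong≃ (P≈Q i)))
                   (D2 i)

  isEisensteinDumas-reverse : ∀ {n} {P : Poly n} → IsEisensteinDumas P → IsEisensteinDumas (reverse P)
  isEisensteinDumas-reverse {n} {P} isED = record { D0 = d0 ; D1 = d1 ; D2 = d2 }
    where
    open IsEisensteinDumas isED
    first≡last : coef (reverse P) 0 ≡ coef P n
    first≡last = coef-reverse P 0 z≤n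
    last≡first : coef (reverse P) n ≡ coef P 0
    last≡first = ≡.trans (coef-reverse P n ℕₚ.≤-refl) (≡.cong (coef P) (ℕₚ.n∸n≡0 n))
    d0 : ¬ (coef (reverse P) 0 F.≈ F.0#) × ¬ (coef (reverse P) n F.≈ F.0#)
    d0 = (proj₂ D0 ∘ ≡.subst (F._≈ F.0#) first≡last) , (proj₁ D0 ∘ ≡.subst (F._≈ F.0#) last≡first)
    d1 : ∀ k → 1 ℕ.< k → k ∣ n → ∀ g₀ gₙ →
         v (coef (reverse P) 0) ≡ fin g₀ → v (coef (reverse P) n) ≡ fin gₙ →
         ∀ γ → ¬ ((k G.·ᵍ γ) G.≈ (g₀ G.-ᵍ gₙ))
    d1 k 1<k k∣n g₀ gₙ v₀ vₙ γ kγ≈ =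
      D1 k 1<k k∣n gₙ g₀
         (≡.trans (≡.cong v (≡.sym last≡first)) vₙ) (≡.trans (≡.cong v (≡.sym first≡last)) v₀)
         (γ G.⁻¹) (G.trans (·ᵍ-⁻¹ k γ) (G.trans (G.⁻¹-cong kγ≈) (⁻¹-anti-homo-// g₀ gₙ)))
    d2 : ∀ i → (((n ∸ toℕ i) ·∞ v (coef (reverse P) 0)) +∞ (toℕ i ·∞ v (coef (reverse P) n)))
               ≤∞ (n ·∞ v (reverse P i))
    d2 i = ≡.subst₂ (λ a₀ aₙ → (((n ∸ toℕ i) ·∞ v a₀) +∞ (toℕ i ·∞ v aₙ)) ≤∞ (n ·∞ v (P (opposite i))))
                    (≡.sym first≡last) (≡.sym last≡first)
                    (≤∞-resp (+∞-comm (toℕ i ·∞ v (coef P 0)) ((n ∸ toℕ i) ·∞ v (coef P n)))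
                             (≃∞-refl (n ·∞ v (P (opposite i))))
                             reindexed)
      where
      reindexed : ((toℕ i ·∞ v (coef P 0)) +∞ ((n ∸ toℕ i) ·∞ v (coef P n))) ≤∞ (n ·∞ v (P (opposite i)))
      reindexed = ≡.subst₂ (λ a b → ((a ·∞ v (coef P 0)) +∞ (b ·∞ v (coef P n))) ≤∞ (n ·∞ v (P (opposite i))))
                           (≡.trans (≡.cong (n ∸_) (opposite-prop i)) (ℕₚ.m∸[m∸n]≡n (toℕ≤pred[n] i)))
                           (opposite-prop i)
                           (D2 (opposite i))

  isEisensteinDumas⇔reverse : ∀ {n} {P : Poly n} → IsEisensteinDumas P ⇔ IsEisensteinDumas (reverse P)
  isEisensteinDumas⇔reverse {P = P} = mk⇔ isEisensteinDumas-reverse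
    (isEisensteinDumas-resp (λ i → F.reflexive (≡.cong P (opposite-involutive i))) ∘ isEisensteinDumas-reverse)

-- The hypotheses a₀ ≠ 0 and aₙ ≠ 0 are not needed: the identity holds for every value of the
-- shift constant, including the junk value produced by division by zero.
proposition1p4 : ∀ {c ℓ c' ℓ₁ ℓ₂ : Level} (K : Field c ℓ) (Γ : LinOrdAbGroup c' ℓ₁ ℓ₂)
    (val : Valuation K Γ) (n : ℕ) (A : Polys.Poly K n) →
    ¬ (Field._≈_ K (Polys.coef K A n) (Field.0# K)) →
    ¬ (Field._≈_ K (Polys.coef K A 0) (Field.0# K)) →
    ¬ (Field._≈_ K (Field.fromℕ K n) (Field.0# K)) →
    Polys._≈ₚ_ K (Polys.U K (Polys.reverse K A)) (Polys.swap K (Polys.L K A))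
    × (ED.IsEisensteinDumas val (Polys.L K A) ⇔ ED.IsEisensteinDumas val (Polys.U K (Polys.reverse K A)))
proposition1p4 K Γ val zero    A _ _ n≉0 = contradiction (Field.refl K) n≉0
proposition1p4 K Γ val (suc m) A _ _ _   =
  U≈swap , mk⇔ (isEisensteinDumas-resp (sym ∘ U≈reverse) ∘ isEisensteinDumas-reverse)
               (Equivalence.from isEisensteinDumas⇔reverse ∘ isEisensteinDumas-resp U≈reverse)
  where
  open Field K using (trans; sym)
  open Polys K
  open Substitutions K using (U-reverse≈ₚreverse-L; swap≈ₚreverse)
  open EisensteinDumasSymmetry val
  U≈reverse : U (reverse A) ≈ₚ reverse (L A)
  U≈reverse = U-reverse≈ₚreverse-L m A
  U≈swap : U (reverse A) ≈ₚ swap (L A)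
  U≈swap j = trans (U≈reverse j) (sym (swap≈ₚreverse (L A) j))
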